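{- Let $k$ be a positive integer and $S=\{3k,3k+1,6k-1\}$, $G=\langle S\rangle$. For $i\in\mathbb{N}$ let $A_{i,k}=[6ik-i,\,6ik+2i]$ and $B_{i,k}=[(2i+1)3k-i,\,(2i+1)3k+2i+1]$, and $H_{1,k}=\bigcup_{i\in\mathbb{N}}(A_{i,k}\cup B_{i,k})$. Then $H_{1,k}$ is a submonoid of $(\mathbb{N},+,0)$ containing $S$, $[(2(k-1)+1)3k-(k-1),\infty[\,\subseteq H_{1,k}$, $G=H_{1,k}$, and $H_{1,k}$ is a $3$-permutation numerical semigroup.
   Context: For $a\le b$ in $\mathbb{N}$, $[a,b]=\{x\in\mathbb{N}: a\le x\le b\}$ and $[a,\infty[\,=\{x\in\mathbb{N}:x\ge a\}$. A numerical semigroup is a submonoid $G$ of $(\mathbb{N},+,0)$ with $\mathbb{N}\setminus G$ finite; $\langle S\rangle$ is the submonoid generated by $S$. Write the elements of $G$ as $0=g_0<g_1<g_2<\cdots$. For $n\ge 1$, $G$ is an $n$-permutation numerical semigroup if $G=\langle g_1,\dots,g_n\rangle$ and for every integer $k\ge 0$ the tuple $(g_{kn+1}\bmod n,\dots,g_{kn+n}\bmod n)$ contains exactly one representative of each residue class of $\mathbb{Z}/n\mathbb{Z}$. -}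

module Defs where

open import Data.Nat using (ℕ; zero; suc; _+_; _*_; _∸_; _≤_; _<_; NonZero)
open import Data.Nat.DivMod using (_%_)
open import Data.Product using (Σ; ∃; _×_; _,_)
open import Data.Sum using (_⊎_)
open import Relation.Nullary using (¬_)
open import Relation.Binary.PropositionalEquality using (_≡_)
open import Function.Bundles using (_⇔_)

Subset : Set₁
Subset = ℕ → Set

IsSubmonoid : Subset → Set
IsSubmonoid H = H 0 × (∀ x y → H x → H y → H (x + y))

IsNumericalSemigroup : Subset → Set
IsNumericalSemigroup H = IsSubmonoid H × ∃ λ N → ∀ x → N ≤ x → H x

data ⟨_⟩ (S : Subset) : Subset where
  gen-zero : ⟨ S ⟩ 0
  gen-add  : ∀ {s x} → S s → ⟨ S ⟩ x → ⟨ S ⟩ (s + x)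

-- Nth G n x : x = g_n, the n-th element (from 0) of G in increasing order
data Nth (G : Subset) : ℕ → ℕ → Set where
  nth-zero : ∀ {x} → G x → (∀ y → y < x → ¬ G y) → Nth G 0 x
  nth-suc  : ∀ {n y x} → Nth G n y → y < x → G x →
             (∀ z → y < z → z < x → ¬ G z) → Nth G (suc n) x

IsPermutationNS : (n : ℕ) → .{{NonZero n}} → Subset → Set
IsPermutationNS n G =
  IsNumericalSemigroup G
  × (∀ x → G x ⇔ ⟨ (λ s → ∃ λ j → 1 ≤ j × j ≤ n × Nth G j s) ⟩ x)
  × (∀ k r → r < n →
       (∃ λ j → 1 ≤ j × j ≤ n × ∃ λ s → Nth G (k * n + j) s × s % n ≡ r)
       × (∀ j j' s s' → 1 ≤ j → j ≤ n → 1 ≤ j' → j' ≤ n →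
            Nth G (k * n + j) s → s % n ≡ r →
            Nth G (k * n + j') s' → s' % n ≡ r → j ≡ j'))

Sk : ℕ → Subset
Sk k x = (x ≡ 3 * k) ⊎ (x ≡ 3 * k + 1) ⊎ (x ≡ 6 * k ∸ 1)

Interval : ℕ → ℕ → Subset
Interval a b x = a ≤ x × x ≤ b

A : ℕ → ℕ → Subset
A i k = Interval (6 * i * k ∸ i) (6 * i * k + 2 * i)

B : ℕ → ℕ → Subset
B i k = Interval ((2 * i + 1) * (3 * k) ∸ i) ((2 * i + 1) * (3 * k) + 2 * i + 1)

H₁ : ℕ → Subset
H₁ k x = ∃ λ i → A i k x ⊎ B i k x

-- Put a = 3k and c = 6k − 1, so that c + 1 = 2a, A_{i,k} = [ic, ic + 3i] and
-- B_{i,k} = [a + ic, a + ic + 3i + 1].  The sum of two of these intervals lies in a third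
-- (B_i + B_l ⊆ A_{i+l+1} because 2a = c + 1), each of them consists of combinations of
-- a, a + 1 and c, and from B_{k-1} on consecutive intervals touch.  Before that they are
-- separated by gaps, in the order A_0 < B_0 < A_1 < B_1 < ⋯, and since |A_i| = 3i + 1 and
-- |B_i| = 3i + 2 the right end of A_i is g_{3i(i+1)}.  So for n ≢ 0 (mod 3) either
-- g_{n+1} = g_n + 1, or g_n ends B_i and g_{n+1} starts A_{i+1}, a jump of a − 3i − 2 ≡ 1;
-- hence every block g_{3m+1}, g_{3m+2}, g_{3m+3} has residues b, b + 1, b + 2 (mod 3).

module Submission where

open import Defs
open import Data.Nat using (ℕ; zero; suc; _+_; _*_; _∸_; _≤_; _<_; _≤?_; z≤n; s≤s; NonZero; >-nonZero)
open import Data.Nat.Properties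
open import Data.Nat.DivMod using (_%_; _/_; m≡m%n+[m/n]*n; m<n⇒m%n≡m; [m+kn]%n≡m%n; %-distribˡ-+; %-remove-+ʳ; m%n<n)
open import Data.Nat.Divisibility using (_∣_; divides; ∣m+n∣m⇒∣n; n∣m*n; m∣m*n; ∣-trans; ∣⇒≤; n∣m⇒m%n≡0)
open import Data.Nat.Tactic.RingSolver using (solve)
open import Algebra.Properties.CommutativeSemigroup +-commutativeSemigroup using (xy∙z≈xz∙y; xy∙z≈zx∙y)
open import Data.List using (_∷_; [])
open import Data.Product using (∃; _×_; _,_; proj₁; proj₂)
open import Data.Sum using (_⊎_; inj₁; inj₂)
open import Data.Empty using (⊥-elim)
open import Function.Base using (_∘_)
open import Function.Bundles using (_⇔_; mk⇔; Equivalence)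
open import Relation.Nullary using (¬_; yes; no)
open import Relation.Nullary.Decidable using (_×-dec_; _⊎-dec_)
open import Relation.Unary using (Decidable; _⊆_; _≐_)
open import Relation.Binary.Definitions using (tri<; tri≈; tri>)
open import Relation.Binary.PropositionalEquality

⟨⟩-+ : ∀ {S x y} → ⟨ S ⟩ x → ⟨ S ⟩ y → ⟨ S ⟩ (x + y)
⟨⟩-+ gen-zero q = q
⟨⟩-+ {S} {y = y} (gen-add {s} {x} p r) q =
  subst ⟨ S ⟩ (sym (+-assoc s x y)) (gen-add p (⟨⟩-+ r q))

⟨⟩-* : ∀ {S s} n → S s → ⟨ S ⟩ (n * s)
⟨⟩-* zero    p = gen-zero
⟨⟩-* (suc n) p = gen-add p (⟨⟩-* n p)

⟨⟩-map : ∀ {S T} → S ⊆ T → ⟨ S ⟩ ⊆ ⟨ T ⟩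
⟨⟩-map S⊆T gen-zero      = gen-zero
⟨⟩-map S⊆T (gen-add p q) = gen-add (S⊆T p) (⟨⟩-map S⊆T q)

⟨⟩-least : ∀ {S M} → IsSubmonoid M → S ⊆ M → ⟨ S ⟩ ⊆ M
⟨⟩-least (M0 , M+) S⊆M gen-zero      = M0
⟨⟩-least (M0 , M+) S⊆M (gen-add p q) = M+ _ _ (S⊆M p) (⟨⟩-least (M0 , M+) S⊆M q)

IsSubmonoid-≐ : ∀ {M N} → M ≐ N → IsSubmonoid M → IsSubmonoid N
IsSubmonoid-≐ (M⊆N , N⊆M) (M0 , M+) = M⊆N M0 , λ x y p q → M⊆N (M+ x y (N⊆M p) (N⊆M q))

-- Enumerating a subset of ℕ in increasing order

module _ {G : Subset} where

  Nth⇒∈ : ∀ {n x} → Nth G n x → G x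
  Nth⇒∈ (nth-zero Gx _)    = Gx
  Nth⇒∈ (nth-suc _ _ Gx _) = Gx

  Nth-functional : ∀ {n x y} → Nth G n x → Nth G n y → x ≡ y
  Nth-functional {x = x} {y} (nth-zero Gx x-least) (nth-zero Gy y-least) with <-cmp x y
  ... | tri< x<y _ _ = ⊥-elim (y-least x x<y Gx)
  ... | tri≈ _ x≡y _ = x≡y
  ... | tri> _ _ y<x = ⊥-elim (x-least y y<x Gy)
  Nth-functional {x = x} {y} (nth-suc p w<x Gx x-gap) (nth-suc q w<y Gy y-gap)
    with refl ← Nth-functional p q with <-cmp x y
  ... | tri< x<y _ _ = ⊥-elim (y-gap x w<x x<y Gx)
  ... | tri≈ _ x≡y _ = x≡y
  ... | tri> _ _ y<x = ⊥-elim (x-gap y w<y y<x Gy)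

  Nth-strictMono : ∀ {m n x y} → m < n → Nth G m x → Nth G n y → x < y
  Nth-strictMono (s≤s m≤n) p (nth-suc q w<y _ _) with m≤n⇒m<n∨m≡n m≤n
  ... | inj₁ m<n  = <-trans (Nth-strictMono m<n p q) w<y
  ... | inj₂ refl = subst (_< _) (Nth-functional q p) w<y

  Nth-injective : ∀ {m n x} → Nth G m x → Nth G n x → m ≡ n
  Nth-injective {m} {n} p q with <-cmp m n
  ... | tri< m<n _ _ = ⊥-elim (<-irrefl refl (Nth-strictMono m<n p q))
  ... | tri≈ _ m≡n _ = m≡n
  ... | tri> _ _ n<m = ⊥-elim (<-irrefl refl (Nth-strictMono n<m q p))

  Nth-along : ∀ {n l} L → Nth G n l → Interval l (l + L) ⊆ G → Nth G (n + L) (l + L)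
  Nth-along {n} {l} zero p I⊆G =
    subst₂ (Nth G) (sym (+-identityʳ n)) (sym (+-identityʳ l)) p
  Nth-along {n} {l} (suc L) p I⊆G = subst₂ (Nth G) (sym (+-suc n L)) (sym (+-suc l L))
    (nth-suc (Nth-along L p (I⊆G ∘ widen)) (n<1+n _) (subst G (+-suc l L) (I⊆G (m≤m+n l _ , ≤-refl)))
      λ z l+L<z z<1+l+L → ⊥-elim (<⇒≱ l+L<z (≤-pred z<1+l+L)))
    where
    widen : Interval l (l + L) ⊆ Interval l (l + suc L)
    widen (l≤x , x≤l+L) = l≤x , ≤-trans x≤l+L (+-monoʳ-≤ l (n≤1+n L))

  next-element : Decidable G → ∀ {y} m d → y < m → (∀ z → y < z → z < m → ¬ G z) →
                 G (m + d) → ∃ λ x → y < x × G x × (∀ z → y < z → z < x → ¬ G z)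
  next-element G? m d y<m gap G[m+d] with G? m | d
  ... | yes Gm | _     = m , y<m , Gm , gap
  ... | no ¬Gm | zero  = ⊥-elim (¬Gm (subst G (+-identityʳ m) G[m+d]))
  ... | no ¬Gm | suc d = next-element G? (suc m) d (m<n⇒m<1+n y<m) gap′ (subst G (+-suc m d) G[m+d])
    where
    gap′ : ∀ z → _ < z → z < suc m → ¬ G z
    gap′ z y<z z<1+m with m≤n⇒m<n∨m≡n (≤-pred z<1+m)
    ... | inj₁ z<m  = gap z y<z z<m
    ... | inj₂ refl = ¬Gm

  Nth-total : Decidable G → G 0 → ∀ N → (∀ x → N ≤ x → G x) → ∀ n → ∃ (Nth G n)
  Nth-total G? G0 N cofinite zero    = 0 , nth-zero G0 λ _ ()
  Nth-total G? G0 N cofinite (suc n) with Nth-total G? G0 N cofinite n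
  ... | y , p with next-element G? (suc y) N ≤-refl (λ z y<z z<1+y → ⊥-elim (<⇒≱ y<z (≤-pred z<1+y)))
                                          (cofinite (suc y + N) (m≤n+m N (suc y)))
  ... | x , y<x , Gx , gap = x , nth-suc p y<x Gx gap

Nth-≐ : ∀ {G G′ n x} → G ≐ G′ → Nth G n x → Nth G′ n x
Nth-≐ (G⊆G′ , G′⊆G) (nth-zero Gx least) = nth-zero (G⊆G′ Gx) λ y y<x → least y y<x ∘ G′⊆G
Nth-≐ e@(G⊆G′ , G′⊆G) (nth-suc p w<x Gx gap) =
  nth-suc (Nth-≐ e p) w<x (G⊆G′ Gx) λ z w<z z<x → gap z w<z z<x ∘ G′⊆G

FirstElements : ℕ → Subset → Subset
FirstElements n G s = ∃ λ j → 1 ≤ j × j ≤ n × Nth G j s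

FirstElements-≐ : ∀ {n G G′} → G ≐ G′ → FirstElements n G ⊆ FirstElements n G′
FirstElements-≐ G≐G′ (j , 1≤j , j≤n , p) = j , 1≤j , j≤n , Nth-≐ G≐G′ p

IsPermutationNS-≐ : ∀ n .{{_ : NonZero n}} {G G′} →
                    G ≐ G′ → IsPermutationNS n G → IsPermutationNS n G′
IsPermutationNS-≐ n {G} {G′} e@(G⊆G′ , G′⊆G) ((submonoid , N , cofinite) , generated , blocks) =
  (IsSubmonoid-≐ e submonoid , N , λ x N≤x → G⊆G′ (cofinite x N≤x)) ,
  (λ x → mk⇔ (⟨⟩-map (FirstElements-≐ e) ∘ Equivalence.to (generated x) ∘ G′⊆G)
             (G⊆G′ ∘ Equivalence.from (generated x) ∘ ⟨⟩-map (FirstElements-≐ e˘))) ,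
  λ m r r<n → block-exists {m} (proj₁ (blocks m r r<n)) ,
    λ j j′ s s′ 1≤j j≤n 1≤j′ j′≤n p ps p′ ps′ →
      proj₂ (blocks m r r<n) j j′ s s′ 1≤j j≤n 1≤j′ j′≤n (Nth-≐ e˘ p) ps (Nth-≐ e˘ p′) ps′
  where
  e˘ : G′ ≐ G
  e˘ = G′⊆G , G⊆G′
  block-exists : ∀ {m r} → (∃ λ j → 1 ≤ j × j ≤ n × ∃ λ s → Nth G (m * n + j) s × s % n ≡ r) →
                 ∃ λ j → 1 ≤ j × j ≤ n × ∃ λ s → Nth G′ (m * n + j) s × s % n ≡ r
  block-exists (j , 1≤j , j≤n , s , p , ps) = j , 1≤j , j≤n , s , Nth-≐ e p , ps

-- Residues modulo n and blocks of n consecutive elements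

module _ {n} .{{_ : NonZero n}} where

  %-cong-suc : ∀ {x y} → x % n ≡ y % n → suc x % n ≡ suc y % n
  %-cong-suc {x} {y} x≡y = begin
    (1 + x) % n              ≡⟨ %-distribˡ-+ 1 x n ⟩
    (1 % n + x % n) % n      ≡⟨ cong (λ r → (1 % n + r) % n) x≡y ⟩
    (1 % n + y % n) % n      ≡⟨ %-distribˡ-+ 1 y n ⟨
    (1 + y) % n              ∎
    where open ≡-Reasoning

  %-≡⇒∣ : ∀ x e → (x + e) % n ≡ x % n → n ∣ e
  %-≡⇒∣ x e eq = ∣m+n∣m⇒∣n (divides ((x + e) / n) (+-cancelˡ-≡ (x % n) _ _ split)) (n∣m*n (x / n))
    where
    open ≡-Reasoning
    split : x % n + (x / n * n + e) ≡ x % n + (x + e) / n * n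
    split = begin
      x % n + (x / n * n + e)    ≡⟨ +-assoc (x % n) _ e ⟨
      x % n + x / n * n + e      ≡⟨ cong (_+ e) (m≡m%n+[m/n]*n x n) ⟨
      x + e                      ≡⟨ m≡m%n+[m/n]*n (x + e) n ⟩
      (x + e) % n + (x + e) / n * n ≡⟨ cong (_+ (x + e) / n * n) eq ⟩
      x % n + (x + e) / n * n    ∎

  %-shift-≢ : ∀ b {d d′} → d < d′ → d′ < n → (b + d) % n ≢ (b + d′) % n
  %-shift-≢ b {d} {d′} d<d′ d′<n eq =
    <⇒≱ (≤-<-trans (m∸n≤m d′ d) d′<n) (∣⇒≤ {{>-nonZero (m<n⇒0<n∸m d<d′)}} n∣d′∸d)
    where
    n∣d′∸d : n ∣ d′ ∸ d
    n∣d′∸d = %-≡⇒∣ (b + d) (d′ ∸ d)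
      (trans (cong (_% n) (trans (+-assoc b d _) (cong (b +_) (m+[n∸m]≡n (<⇒≤ d<d′))))) (sym eq))

  %-shift-injective : ∀ b {d d′} → d < n → d′ < n → (b + d) % n ≡ (b + d′) % n → d ≡ d′
  %-shift-injective b {d} {d′} d<n d′<n eq with <-cmp d d′
  ... | tri< d<d′ _ _ = ⊥-elim (%-shift-≢ b d<d′ d′<n eq)
  ... | tri≈ _ d≡d′ _ = d≡d′
  ... | tri> _ _ d′<d = ⊥-elim (%-shift-≢ b d′<d d<n (sym eq))

  %-≡-remainder : ∀ {x r} q → r < n → x ≡ r + q * n → x % n ≡ r
  %-≡-remainder {r = r} q r<n refl = trans ([m+kn]%n≡m%n r q n) (m<n⇒m%n≡m r<n)

  %-shift-surjective : ∀ b {r} → r < n → ∃ λ d → d < n × (b + d) % n ≡ r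
  %-shift-surjective b r<n = subst (λ b → ∃ λ d → d < n × (b + d) % n ≡ _) (sym (m≡m%n+[m/n]*n b n))
    (surjective (b % n) (b / n) (m%n<n b n) r<n)
    where
    surjective : ∀ t q {r} → t < n → r < n → ∃ λ d → d < n × (t + q * n + d) % n ≡ r
    surjective t q {r} t<n r<n with ≤-<-connex t r
    ... | inj₁ t≤r = r ∸ t , ≤-<-trans (m∸n≤m r t) r<n , %-≡-remainder q r<n (begin
      t + q * n + (r ∸ t)  ≡⟨ xy∙z≈xz∙y t (q * n) (r ∸ t) ⟩
      t + (r ∸ t) + q * n  ≡⟨ cong (_+ q * n) (m+[n∸m]≡n t≤r) ⟩
      r + q * n            ∎)
      where open ≡-Reasoning
    ... | inj₂ r<t = n + r ∸ t , +-cancelʳ-< t _ _ d+t<n+t , %-≡-remainder (suc q) r<n (begin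
      t + q * n + d        ≡⟨ xy∙z≈zx∙y t (q * n) d ⟩
      (d + t) + q * n      ≡⟨ cong (_+ q * n) d+t≡n+r ⟩
      n + r + q * n        ≡⟨ solve (n ∷ r ∷ q ∷ []) ⟩
      r + suc q * n        ∎)
      where
      open ≡-Reasoning
      d = n + r ∸ t
      d+t≡n+r : d + t ≡ n + r
      d+t≡n+r = m∸n+n≡m (≤-trans (<⇒≤ t<n) (m≤m+n n r))
      d+t<n+t : d + t < n + t
      d+t<n+t = subst (_< n + t) (sym d+t≡n+r) (+-monoʳ-< n r<t)

module _ {G : Subset} (n : ℕ) .{{_ : NonZero n}} (total : ∀ i → ∃ (Nth G i))
         (step : ∀ {i y x} → i % n ≢ 0 → Nth G i y → Nth G (suc i) x → x % n ≡ suc y % n) where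

  private
    g : ℕ → ℕ
    g i = proj₁ (total i)

    g-Nth : ∀ i → Nth G i (g i)
    g-Nth i = proj₂ (total i)

  block-residue : ∀ m d {x} → d < n → Nth G (m * n + suc d) x → x % n ≡ (g (m * n + 1) + d) % n
  block-residue m zero    _     p = cong (_% n) (trans (Nth-functional p (g-Nth _)) (sym (+-identityʳ _)))
  block-residue m (suc d) {x} 1+d<n p = begin
    x % n                      ≡⟨ step i%n≢0 (g-Nth i) (subst (λ j → Nth G j x) (+-suc (m * n) (suc d)) p) ⟩
    suc (g i) % n              ≡⟨ %-cong-suc (block-residue m d (<-trans (n<1+n d) 1+d<n) (g-Nth i)) ⟩
    suc (g (m * n + 1) + d) % n ≡⟨ cong (_% n) (+-suc _ d) ⟨
    (g (m * n + 1) + suc d) % n ∎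
    where
    open ≡-Reasoning
    i = m * n + suc d
    i%n≢0 : i % n ≢ 0
    i%n≢0 = 1+n≢0 ∘ trans (sym (%-≡-remainder m 1+d<n (+-comm (m * n) (suc d))))

  block-residues-unique : ∀ m r j j′ s s′ → 1 ≤ j → j ≤ n → 1 ≤ j′ → j′ ≤ n →
    Nth G (m * n + j) s → s % n ≡ r → Nth G (m * n + j′) s′ → s′ % n ≡ r → j ≡ j′
  block-residues-unique m r (suc d) (suc d′) s s′ _ d<n _ d′<n p s≡r p′ s′≡r =
    cong suc (%-shift-injective (g (m * n + 1)) d<n d′<n
      (trans (sym (block-residue m d d<n p))
        (trans s≡r (trans (sym s′≡r) (block-residue m d′ d′<n p′)))))

  block-residues-complete : ∀ m {r} → r < n →
    ∃ λ j → 1 ≤ j × j ≤ n × ∃ λ s → Nth G (m * n + j) s × s % n ≡ r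
  block-residues-complete m r<n with %-shift-surjective (g (m * n + 1)) r<n
  ... | d , d<n , hits-r =
    suc d , s≤s z≤n , d<n , g (m * n + suc d) , g-Nth _ , trans (block-residue m d d<n (g-Nth _)) hits-r

Interval-+ : ∀ {l u l′ u′ x y} →
             Interval l u x → Interval l′ u′ y → Interval (l + l′) (u + u′) (x + y)
Interval-+ (l≤x , x≤u) (l′≤y , y≤u′) = +-mono-≤ l≤x l′≤y , +-mono-≤ x≤u y≤u′

Interval-widen : ∀ {l u l′ u′ x} → l′ ≤ l → u ≤ u′ → Interval l u x → Interval l′ u′ x
Interval-widen l′≤l u≤u′ (l≤x , x≤u) = ≤-trans l′≤l l≤x , ≤-trans x≤u u≤u′

Interval-offset : ∀ {l L x} → Interval l (l + L) x → ∃ λ d → d ≤ L × x ≡ l + d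
Interval-offset {l} {L} {x} (l≤x , x≤l+L) =
  x ∸ l , +-cancelˡ-≤ l _ _ (subst (_≤ l + L) (sym l+d≡x) x≤l+L) , sym l+d≡x
  where
  l+d≡x : l + (x ∸ l) ≡ x
  l+d≡x = m+[n∸m]≡n l≤x

Interval-suc : ∀ {l u x} → Interval l u x → Interval l u (suc x) ⊎ x ≡ u
Interval-suc (l≤x , x≤u) with m≤n⇒m<n∨m≡n x≤u
... | inj₁ x<u = inj₁ (m≤n⇒m≤1+n l≤x , x<u)
... | inj₂ x≡u = inj₂ x≡u

Interval? : ∀ l u → Decidable (Interval l u)
Interval? l u x = (l ≤? x) ×-dec (x ≤? u)

-- The semigroup ⟨a, a + 1, c⟩ with c + 1 = 2a as a union of intervals

module IntervalSemigroup (a c : ℕ) (c+1≡a+a : c + 1 ≡ a + a) where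

  A′ B′ : ℕ → Subset
  A′ i = Interval (i * c) (i * c + 3 * i)
  B′ i = Interval (a + i * c) (a + i * c + suc (3 * i))

  H : Subset
  H x = ∃ λ i → A′ i x ⊎ B′ i x

  S : Subset
  S x = x ≡ a ⊎ x ≡ a + 1 ⊎ x ≡ c

  1≤a : 1 ≤ a
  1≤a = n≢0⇒n>0 λ { refl → 1+n≢0 (trans (+-comm 1 c) c+1≡a+a) }

  a≤c : a ≤ c
  a≤c = +-cancelʳ-≤ 1 a c (subst (a + 1 ≤_) (sym c+1≡a+a) (+-monoʳ-≤ a 1≤a))

  A′+A′ : ∀ {i l x y} → A′ i x → A′ l y → A′ (i + l) (x + y)
  A′+A′ {i} {l} p q = Interval-widen (≤-reflexive lo) (≤-reflexive hi) (Interval-+ p q)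
    where
    lo : (i + l) * c ≡ i * c + l * c
    lo = *-distribʳ-+ c i l
    hi : i * c + 3 * i + (l * c + 3 * l) ≡ (i + l) * c + 3 * (i + l)
    hi = solve (i ∷ l ∷ c ∷ [])

  A′+B′ : ∀ {i l x y} → A′ i x → B′ l y → B′ (i + l) (x + y)
  A′+B′ {i} {l} p q = Interval-widen (≤-reflexive lo) (≤-reflexive hi) (Interval-+ p q)
    where
    lo : a + (i + l) * c ≡ i * c + (a + l * c)
    lo = solve (a ∷ i ∷ l ∷ c ∷ [])
    hi : i * c + 3 * i + (a + l * c + suc (3 * l)) ≡ a + (i + l) * c + suc (3 * (i + l))
    hi = solve (a ∷ i ∷ l ∷ c ∷ [])

  B′+B′ : ∀ {i l x y} → B′ i x → B′ l y → A′ (suc (i + l)) (x + y)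
  B′+B′ {i} {l} p q = Interval-widen lo (≤-reflexive hi) (Interval-+ p q)
    where
    open ≡-Reasoning
    lo : suc (i + l) * c ≤ a + i * c + (a + l * c)
    lo = ≤-trans (m≤m+n _ 1) (≤-reflexive (begin
      suc (i + l) * c + 1         ≡⟨ solve (i ∷ l ∷ c ∷ []) ⟩
      (c + 1) + (i + l) * c       ≡⟨ cong (_+ (i + l) * c) c+1≡a+a ⟩
      (a + a) + (i + l) * c       ≡⟨ solve (a ∷ i ∷ l ∷ c ∷ []) ⟩
      a + i * c + (a + l * c)     ∎))
    hi : a + i * c + suc (3 * i) + (a + l * c + suc (3 * l)) ≡ suc (i + l) * c + 3 * suc (i + l)
    hi = begin
      a + i * c + suc (3 * i) + (a + l * c + suc (3 * l)) ≡⟨ solve (a ∷ i ∷ l ∷ c ∷ []) ⟩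
      (a + a) + ((i + l) * c + 3 * (i + l) + 2)
        ≡⟨ cong (_+ ((i + l) * c + 3 * (i + l) + 2)) c+1≡a+a ⟨
      (c + 1) + ((i + l) * c + 3 * (i + l) + 2)           ≡⟨ solve (i ∷ l ∷ c ∷ []) ⟩
      suc (i + l) * c + 3 * suc (i + l)                   ∎

  H-+ : ∀ x y → H x → H y → H (x + y)
  H-+ x y (i , inj₁ p) (l , inj₁ q) = i + l , inj₁ (A′+A′ {i} {l} p q)
  H-+ x y (i , inj₁ p) (l , inj₂ q) = i + l , inj₂ (A′+B′ {i} {l} p q)
  H-+ x y (i , inj₂ p) (l , inj₁ q) = l + i , inj₂ (subst (B′ (l + i)) (+-comm y x) (A′+B′ {l} {i} q p))
  H-+ x y (i , inj₂ p) (l , inj₂ q) = suc (i + l) , inj₁ (B′+B′ {i} {l} p q)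

  H-isSubmonoid : IsSubmonoid H
  H-isSubmonoid = (0 , inj₁ (z≤n , z≤n)) , H-+

  S⊆H : S ⊆ H
  S⊆H (inj₁ refl)        = 0 , inj₂ (≤-reflexive a+0≡a , ≤-trans (≤-reflexive (sym a+0≡a)) (m≤m+n _ 1))
    where a+0≡a = +-identityʳ a
  S⊆H (inj₂ (inj₁ refl)) = 0 , inj₂ (≤-trans (≤-reflexive a+0≡a) (m≤m+n a 1) ,
                                     ≤-reflexive (cong (_+ 1) (sym a+0≡a)))
    where a+0≡a = +-identityʳ a
  S⊆H (inj₂ (inj₂ refl)) = 1 , inj₁ (≤-reflexive c+0≡c , ≤-trans (≤-reflexive (sym c+0≡c)) (m≤m+n _ 3))
    where c+0≡c = +-identityʳ c

  A′⊆⟨S⟩ : ∀ {i} → A′ i ⊆ ⟨ S ⟩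
  A′⊆⟨S⟩ {i} x∈A′ with Interval-offset x∈A′
  ... | d , d≤3i , refl with ≤-total d i
  ...   | inj₁ d≤i with i ∸ d | m+[n∸m]≡n d≤i
  ...     | s | refl = subst ⟨ S ⟩ (begin
    s * c + (d + d) * a     ≡⟨ solve (s ∷ d ∷ c ∷ a ∷ []) ⟩
    s * c + d * (a + a)     ≡⟨ cong (λ m → s * c + d * m) c+1≡a+a ⟨
    s * c + d * (c + 1)     ≡⟨ solve (s ∷ d ∷ c ∷ []) ⟩
    (d + s) * c + d         ∎) (⟨⟩-+ (⟨⟩-* s (inj₂ (inj₂ refl))) (⟨⟩-* (d + d) (inj₁ refl)))
    where open ≡-Reasoning
  A′⊆⟨S⟩ {i} x∈A′ | d , d≤3i , refl | inj₂ i≤d with d ∸ i | m+[n∸m]≡n i≤d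
  ...     | t | refl with (i + i) ∸ t | m+[n∸m]≡n (+-cancelˡ-≤ i t (i + i)
                                          (subst (i + t ≤_) (cong (λ m → i + (i + m)) (+-identityʳ i)) d≤3i))
  ...       | u | t+u≡i+i = subst ⟨ S ⟩ (begin
    t * (a + 1) + u * a     ≡⟨ solve (t ∷ u ∷ a ∷ []) ⟩
    (t + u) * a + t         ≡⟨ cong (λ m → m * a + t) t+u≡i+i ⟩
    (i + i) * a + t         ≡⟨ solve (i ∷ a ∷ t ∷ []) ⟩
    i * (a + a) + t         ≡⟨ cong (λ m → i * m + t) c+1≡a+a ⟨
    i * (c + 1) + t         ≡⟨ solve (i ∷ c ∷ t ∷ []) ⟩
    i * c + (i + t)         ∎) (⟨⟩-+ (⟨⟩-* t (inj₂ (inj₁ refl))) (⟨⟩-* u (inj₁ refl)))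
    where open ≡-Reasoning

  B′⊆⟨S⟩ : ∀ {i} → B′ i ⊆ ⟨ S ⟩
  B′⊆⟨S⟩ {i} x∈B′ with Interval-offset x∈B′
  ... | d , d≤1+3i , refl with m≤n⇒m<n∨m≡n d≤1+3i
  ...   | inj₁ (s≤s d≤3i) = subst ⟨ S ⟩ (sym (+-assoc a (i * c) d))
    (gen-add (inj₁ refl) (A′⊆⟨S⟩ {i} (m≤m+n _ d , +-monoʳ-≤ (i * c) d≤3i)))
  ...   | inj₂ refl =
    subst ⟨ S ⟩ end≡a+1+A′-end (gen-add (inj₂ (inj₁ refl)) (A′⊆⟨S⟩ {i} (m≤m+n _ _ , ≤-refl)))
    where
    end≡a+1+A′-end : a + 1 + (i * c + 3 * i) ≡ a + i * c + suc (3 * i)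
    end≡a+1+A′-end = solve (a ∷ i ∷ c ∷ [])

  H⊆⟨S⟩ : H ⊆ ⟨ S ⟩
  H⊆⟨S⟩ (i , inj₁ x∈A′) = A′⊆⟨S⟩ {i} x∈A′
  H⊆⟨S⟩ (i , inj₂ x∈B′) = B′⊆⟨S⟩ {i} x∈B′

  ⟨S⟩⊆H : ⟨ S ⟩ ⊆ H
  ⟨S⟩⊆H = ⟨⟩-least H-isSubmonoid S⊆H

  A′-end-suc∈B′ : ∀ {i} → a ≤ suc (3 * i) → B′ i (suc (i * c + 3 * i))
  A′-end-suc∈B′ {i} a≤1+3i =
    (begin
      a + i * c                ≤⟨ +-monoˡ-≤ (i * c) a≤1+3i ⟩
      suc (3 * i) + i * c      ≡⟨ +-comm (suc (3 * i)) (i * c) ⟩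
      i * c + suc (3 * i)      ≡⟨ +-suc (i * c) (3 * i) ⟩
      suc (i * c + 3 * i)      ∎) ,
    (begin
      suc (i * c + 3 * i)      ≡⟨ +-suc (i * c) (3 * i) ⟨
      i * c + suc (3 * i)      ≤⟨ m≤n+m _ a ⟩
      a + (i * c + suc (3 * i)) ≡⟨ +-assoc a _ _ ⟨
      a + i * c + suc (3 * i)  ∎)
    where open ≤-Reasoning

  B′-end-suc∈A′ : ∀ {i} → a ≤ 3 * suc i → A′ (suc i) (suc (a + i * c + suc (3 * i)))
  B′-end-suc∈A′ {i} a≤3+3i = +-cancelʳ-≤ 1 _ _ (begin
      suc i * c + 1                    ≡⟨ solve (i ∷ c ∷ []) ⟩
      (c + 1) + i * c                  ≡⟨ cong (_+ i * c) c+1≡a+a ⟩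
      (a + a) + i * c                  ≤⟨ +-monoˡ-≤ (i * c) (+-monoʳ-≤ a a≤3+3i) ⟩
      (a + 3 * suc i) + i * c          ≡⟨ solve (a ∷ i ∷ c ∷ []) ⟩
      suc (a + i * c + suc (3 * i)) + 1 ∎) ,
    (begin
      suc (a + i * c + suc (3 * i))    ≡⟨ solve (a ∷ i ∷ c ∷ []) ⟩
      a + (i * c + 3 * i + 2)          ≤⟨ +-monoˡ-≤ _ (≤-trans a≤c (m≤m+n c 1)) ⟩
      (c + 1) + (i * c + 3 * i + 2)    ≡⟨ solve (i ∷ c ∷ []) ⟩
      suc i * c + 3 * suc i            ∎)
    where open ≤-Reasoning

  private
    -- a ≤ 3 (j + 1) is exactly the condition for B′ j and A′ (j + 1) to touch.
    Covered : Subset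
    Covered x = ∃ λ j → a ≤ 3 * suc j × (B′ j x ⊎ A′ (suc j) x)

    Covered-suc : ∀ {x} → Covered x → Covered (suc x)
    Covered-suc (j , a≤3+3j , inj₁ x∈B′) with Interval-suc x∈B′
    ... | inj₁ 1+x∈B′ = j , a≤3+3j , inj₁ 1+x∈B′
    ... | inj₂ refl   = j , a≤3+3j , inj₂ (B′-end-suc∈A′ {j} a≤3+3j)
    Covered-suc (j , a≤3+3j , inj₂ x∈A′) with Interval-suc x∈A′
    ... | inj₁ 1+x∈A′ = j , a≤3+3j , inj₂ 1+x∈A′
    ... | inj₂ refl   = suc j , ≤-trans a≤3+3j (*-monoʳ-≤ 3 (n≤1+n (suc j))) ,
                        inj₁ (A′-end-suc∈B′ {suc j} (m≤n⇒m≤1+n a≤3+3j))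

    Covered-from : ∀ i → a ≤ 3 * suc i → ∀ d → Covered (a + i * c + d)
    Covered-from i a≤3+3i zero    = i , a≤3+3i , inj₁ (≤-reflexive (sym (+-identityʳ _)) , +-monoʳ-≤ _ z≤n)
    Covered-from i a≤3+3i (suc d) = subst Covered (sym (+-suc _ d)) (Covered-suc (Covered-from i a≤3+3i d))

    Covered⇒H : Covered ⊆ H
    Covered⇒H (j , _ , inj₁ x∈B′) = j , inj₂ x∈B′
    Covered⇒H (j , _ , inj₂ x∈A′) = suc j , inj₁ x∈A′

  H-cofinite : ∀ i → a ≤ 3 * suc i → ∀ x → a + i * c ≤ x → H x
  H-cofinite i a≤3+3i x start≤x =
    Covered⇒H (subst Covered (m+[n∸m]≡n start≤x) (Covered-from i a≤3+3i (x ∸ (a + i * c))))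

  A′-end-mono : ∀ {l i} → l ≤ i → l * c + 3 * l ≤ i * c + 3 * i
  A′-end-mono l≤i = +-mono-≤ (*-monoˡ-≤ c l≤i) (*-monoʳ-≤ 3 l≤i)

  B′-end-mono : ∀ {l i} → l ≤ i → a + l * c + suc (3 * l) ≤ a + i * c + suc (3 * i)
  B′-end-mono l≤i = +-mono-≤ (+-monoʳ-≤ a (*-monoˡ-≤ c l≤i)) (s≤s (*-monoʳ-≤ 3 l≤i))

  A′-end≤B′-end : ∀ i → i * c + 3 * i ≤ a + i * c + suc (3 * i)
  A′-end≤B′-end i = ≤-trans (+-monoʳ-≤ (i * c) (n≤1+n _))
    (≤-trans (m≤n+m _ a) (≤-reflexive (sym (+-assoc a (i * c) _))))

  B′-end≤next-A′-end : ∀ i → a + i * c + suc (3 * i) ≤ suc i * c + 3 * suc i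
  B′-end≤next-A′-end i = begin
    a + i * c + suc (3 * i)      ≤⟨ +-monoˡ-≤ _ (+-monoˡ-≤ (i * c) a≤c) ⟩
    c + i * c + suc (3 * i)      ≤⟨ m≤m+n _ 2 ⟩
    c + i * c + suc (3 * i) + 2  ≡⟨ solve (i ∷ c ∷ []) ⟩
    suc i * c + 3 * suc i        ∎
    where open ≤-Reasoning

  H-split-A′ : ∀ i {z} → H z → z ≤ i * c + 3 * i ⊎ a + i * c ≤ z
  H-split-A′ i (l , inj₁ (lo , hi)) with ≤-<-connex l i
  ... | inj₁ l≤i = inj₁ (≤-trans hi (A′-end-mono l≤i))
  ... | inj₂ i<l = inj₂ (≤-trans (+-monoˡ-≤ (i * c) a≤c) (≤-trans (*-monoˡ-≤ c i<l) lo))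
  H-split-A′ i (l , inj₂ (lo , hi)) with <-≤-connex l i
  ... | inj₁ l<i = inj₁ (≤-trans hi (≤-trans (B′-end≤next-A′-end l) (A′-end-mono l<i)))
  ... | inj₂ i≤l = inj₂ (≤-trans (+-monoʳ-≤ a (*-monoˡ-≤ c i≤l)) lo)

  H-split-B′ : ∀ i {z} → H z → z ≤ a + i * c + suc (3 * i) ⊎ suc i * c ≤ z
  H-split-B′ i (l , inj₁ (lo , hi)) with ≤-<-connex l i
  ... | inj₁ l≤i = inj₁ (≤-trans hi (≤-trans (A′-end-mono l≤i) (A′-end≤B′-end i)))
  ... | inj₂ i<l = inj₂ (≤-trans (*-monoˡ-≤ c i<l) lo)
  H-split-B′ i (l , inj₂ (lo , hi)) with ≤-<-connex l i
  ... | inj₁ l≤i = inj₁ (≤-trans hi (B′-end-mono l≤i))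
  ... | inj₂ i<l = inj₂ (≤-trans (*-monoˡ-≤ c i<l) (≤-trans (m≤n+m _ a) lo))

  H? : Decidable H
  H? x with anyUpTo? (λ i → Interval? (i * c) (i * c + 3 * i) x ⊎-dec
                            Interval? (a + i * c) (a + i * c + suc (3 * i)) x) (suc x)
  ... | yes (i , _ , x∈) = yes (i , x∈)
  ... | no ∄ = no λ (i , x∈) → ∄ (i , s≤s (index≤x x∈) , x∈)
    where
    i≤i*c : ∀ i → i ≤ i * c
    i≤i*c i = m≤m*n i c {{>-nonZero (≤-trans 1≤a a≤c)}}
    index≤x : ∀ {i} → A′ i x ⊎ B′ i x → i ≤ x
    index≤x {i} (inj₁ (lo , _)) = ≤-trans (i≤i*c i) lo
    index≤x {i} (inj₂ (lo , _)) = ≤-trans (i≤i*c i) (≤-trans (m≤n+m _ a) lo)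

  H-before-gap : ∀ {y} → H y → ¬ H (suc y) →
      (∃ λ i → suc (3 * i) < a × y ≡ i * c + 3 * i)
    ⊎ (∃ λ i → 3 * suc i < a × y ≡ a + i * c + suc (3 * i))
  H-before-gap (i , inj₁ y∈A′) ∉H with Interval-suc y∈A′
  ... | inj₁ 1+y∈A′ = ⊥-elim (∉H (i , inj₁ 1+y∈A′))
  ... | inj₂ refl with a ≤? suc (3 * i)
  ...   | yes a≤1+3i = ⊥-elim (∉H (i , inj₂ (A′-end-suc∈B′ {i} a≤1+3i)))
  ...   | no  a≰1+3i = inj₁ (i , ≰⇒> a≰1+3i , refl)
  H-before-gap (i , inj₂ y∈B′) ∉H with Interval-suc y∈B′
  ... | inj₁ 1+y∈B′ = ⊥-elim (∉H (i , inj₂ 1+y∈B′))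
  ... | inj₂ refl with a ≤? 3 * suc i
  ...   | yes a≤3+3i = ⊥-elim (∉H (suc i , inj₁ (B′-end-suc∈A′ {i} a≤3+3i)))
  ...   | no  a≰3+3i = inj₂ (i , ≰⇒> a≰3+3i , refl)

  Nth-across-A′-gap : ∀ {i n} → 3 * i < a → Nth H n (i * c + 3 * i) → Nth H (suc n) (a + i * c)
  Nth-across-A′-gap {i} 3i<a p = nth-suc p end<start (i , inj₂ (≤-refl , m≤m+n _ _)) gap
    where
    end<start : i * c + 3 * i < a + i * c
    end<start = subst (_≤ a + i * c) (+-suc (i * c) (3 * i))
      (≤-trans (+-monoʳ-≤ (i * c) 3i<a) (≤-reflexive (+-comm (i * c) a)))
    gap : ∀ z → i * c + 3 * i < z → z < a + i * c → ¬ H z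
    gap z end<z z<start Hz with H-split-A′ i Hz
    ... | inj₁ z≤end   = <⇒≱ end<z z≤end
    ... | inj₂ start≤z = <⇒≱ z<start start≤z

  Nth-across-B′-gap : ∀ {i n} → 3 * suc i ≤ a →
                      Nth H n (a + i * c + suc (3 * i)) → Nth H (suc n) (suc i * c)
  Nth-across-B′-gap {i} 3+3i≤a p = nth-suc p end<start (suc i , inj₁ (≤-refl , m≤m+n _ _)) gap
    where
    end<start : a + i * c + suc (3 * i) < suc i * c
    end<start = +-cancelʳ-≤ 1 _ _ (begin
      suc (a + i * c + suc (3 * i)) + 1 ≡⟨ solve (a ∷ i ∷ c ∷ []) ⟩
      (a + 3 * suc i) + i * c           ≤⟨ +-monoˡ-≤ (i * c) (+-monoʳ-≤ a 3+3i≤a) ⟩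
      (a + a) + i * c                   ≡⟨ cong (_+ i * c) c+1≡a+a ⟨
      (c + 1) + i * c                   ≡⟨ solve (i ∷ c ∷ []) ⟩
      suc i * c + 1                     ∎)
      where open ≤-Reasoning
    gap : ∀ z → a + i * c + suc (3 * i) < z → z < suc i * c → ¬ H z
    gap z end<z z<start Hz with H-split-B′ i Hz
    ... | inj₁ z≤end   = <⇒≱ end<z z≤end
    ... | inj₂ start≤z = <⇒≱ z<start start≤z

  Nth-A′-end : ∀ i → 3 * i ≤ a → Nth H (3 * i * suc i) (i * c + 3 * i)
  Nth-A′-end zero    _      = nth-zero (0 , inj₁ (z≤n , z≤n)) λ _ ()
  Nth-A′-end (suc i) 3+3i≤a = subst (λ n → Nth H n (suc i * c + 3 * suc i)) index
    (Nth-along (3 * suc i)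
      (Nth-across-B′-gap {i} 3+3i≤a
        (Nth-along (suc (3 * i))
          (Nth-across-A′-gap {i} 3i<a (Nth-A′-end i (<⇒≤ 3i<a)))
          λ x∈B′ → i , inj₂ x∈B′))
      λ x∈A′ → suc i , inj₁ x∈A′)
    where
    3i<a : 3 * i < a
    3i<a = <-≤-trans (*-monoʳ-< 3 (n<1+n i)) 3+3i≤a
    index : suc (suc (3 * i * suc i) + suc (3 * i)) + 3 * suc i ≡ 3 * suc i * suc (suc i)
    index = solve (i ∷ [])

  module _ (3∣a : 3 ∣ a) where

    Nth-residue-step : ∀ {n y x} → n % 3 ≢ 0 → Nth H n y → Nth H (suc n) x → x % 3 ≡ suc y % 3
    Nth-residue-step {n} {y} {x} n%3≢0 p q with H? (suc y)
    ... | yes H[1+y] = cong (_% 3) (Nth-functional q (nth-suc p (n<1+n y) H[1+y]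
                         λ z y<z z<1+y → ⊥-elim (<⇒≱ y<z (≤-pred z<1+y))))
    ... | no ∉H with H-before-gap (Nth⇒∈ p) ∉H
    ...   | inj₁ (i , 1+3i<a , refl) =
      ⊥-elim (n%3≢0 (subst (λ m → m % 3 ≡ 0) (Nth-injective (Nth-A′-end i 3i≤a) p)
                            (n∣m⇒m%n≡0 _ 3 (∣-trans (m∣m*n i) (m∣m*n (suc i))))))
      where
      3i≤a : 3 * i ≤ a
      3i≤a = <⇒≤ (≤-trans (n≤1+n _) 1+3i<a)
    ...   | inj₂ (i , 3+3i<a , refl)
      with refl ← Nth-functional q (Nth-across-B′-gap {i} (<⇒≤ 3+3i<a) p) = begin
      (suc i * c) % 3                       ≡⟨ %-remove-+ʳ (suc i * c) (m∣m*n (suc i)) ⟨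
      (suc i * c + 3 * suc i) % 3           ≡⟨ cong (_% 3) jump ⟩
      (suc (a + i * c + suc (3 * i)) + a) % 3 ≡⟨ %-remove-+ʳ (suc (a + i * c + suc (3 * i))) 3∣a ⟩
      suc (a + i * c + suc (3 * i)) % 3     ∎
      where
      open ≡-Reasoning
      jump : suc i * c + 3 * suc i ≡ suc (a + i * c + suc (3 * i)) + a
      jump = begin
        suc i * c + 3 * suc i                 ≡⟨ solve (i ∷ c ∷ []) ⟩
        (c + 1) + (i * c + 3 * i + 2)         ≡⟨ cong (_+ (i * c + 3 * i + 2)) c+1≡a+a ⟩
        (a + a) + (i * c + 3 * i + 2)         ≡⟨ solve (a ∷ i ∷ c ∷ []) ⟩
        suc (a + i * c + suc (3 * i)) + a     ∎

    3≤a : 3 ≤ a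
    3≤a = ∣⇒≤ {{>-nonZero 1≤a}} 3∣a

    Nth-a : Nth H 1 a
    Nth-a = subst (Nth H 1) (+-identityʳ a)
      (Nth-across-A′-gap {0} (≤-trans (s≤s z≤n) 3≤a) (Nth-A′-end 0 z≤n))

    Nth-a+1 : Nth H 2 (a + 1)
    Nth-a+1 = Nth-along 1 Nth-a λ x∈ →
      0 , inj₂ (Interval-widen (≤-reflexive a+0≡a) (≤-reflexive (cong (_+ 1) (sym a+0≡a))) x∈)
      where a+0≡a = +-identityʳ a

    Nth-c : Nth H 3 c
    Nth-c = subst (Nth H 3) (+-identityʳ c)
      (Nth-across-B′-gap {0} 3≤a (subst (λ x → Nth H 2 (x + 1)) (sym (+-identityʳ a)) Nth-a+1))

    S⊆FirstElements : S ⊆ FirstElements 3 H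
    S⊆FirstElements (inj₁ refl)        = 1 , s≤s z≤n , s≤s z≤n , Nth-a
    S⊆FirstElements (inj₂ (inj₁ refl)) = 2 , s≤s z≤n , s≤s (s≤s z≤n) , Nth-a+1
    S⊆FirstElements (inj₂ (inj₂ refl)) = 3 , s≤s z≤n , ≤-refl , Nth-c

    FirstElements⊆S : FirstElements 3 H ⊆ S
    FirstElements⊆S (1 , _ , _ , p) = inj₁ (Nth-functional p Nth-a)
    FirstElements⊆S (2 , _ , _ , p) = inj₂ (inj₁ (Nth-functional p Nth-a+1))
    FirstElements⊆S (3 , _ , _ , p) = inj₂ (inj₂ (Nth-functional p Nth-c))
    FirstElements⊆S (suc (suc (suc (suc _))) , _ , s≤s (s≤s (s≤s ())) , _)

    H-isPermutationNS : IsPermutationNS 3 H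
    H-isPermutationNS =
      (H-isSubmonoid , a + a * c , H-cofinite a a≤3+3a) ,
      (λ x → mk⇔ (⟨⟩-map S⊆FirstElements ∘ H⊆⟨S⟩) (⟨S⟩⊆H ∘ ⟨⟩-map FirstElements⊆S)) ,
      λ m r r<3 → block-residues-complete 3 total Nth-residue-step m r<3 ,
                  block-residues-unique 3 total Nth-residue-step m r
      where
      a≤3+3a : a ≤ 3 * suc a
      a≤3+3a = ≤-trans (n≤1+n a) (m≤m+n (suc a) _)
      total : ∀ n → ∃ (Nth H n)
      total = Nth-total H? (0 , inj₁ (z≤n , z≤n)) (a + a * c) (H-cofinite a a≤3+3a)

-- The paper's H₁

-- 6 * suc k ∸ 1 reduces to k + 5 * suc k; the ring solver only accepts the latter form.
6[1+k]∸1+1≡3[1+k]+3[1+k] : ∀ k → 6 * suc k ∸ 1 + 1 ≡ 3 * suc k + 3 * suc k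
6[1+k]∸1+1≡3[1+k]+3[1+k] k = c+1≡a+a
  where
  c+1≡a+a : k + 5 * suc k + 1 ≡ 3 * suc k + 3 * suc k
  c+1≡a+a = solve (k ∷ [])

-- H₁-intervals k describes H₁ (suc k).
module H₁-intervals (k : ℕ) = IntervalSemigroup (3 * suc k) (6 * suc k ∸ 1) (6[1+k]∸1+1≡3[1+k]+3[1+k] k)

module _ (k : ℕ) where
  open H₁-intervals k

  B-start≡B′-start : ∀ i → (2 * i + 1) * (3 * suc k) ∸ i ≡ 3 * suc k + i * (6 * suc k ∸ 1)
  B-start≡B′-start i = trans (cong (_∸ i) expand) (m+n∸n≡m _ i)
    where
    expand : (2 * i + 1) * (3 * suc k) ≡ 3 * suc k + i * (k + 5 * suc k) + i
    expand = solve (i ∷ k ∷ [])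

  A≡A′ : ∀ i → A i (suc k) ≡ A′ i
  A≡A′ i = cong₂ Interval (trans (cong (_∸ i) expand) (m+n∸n≡m _ i)) end
    where
    expand : 6 * i * suc k ≡ i * (k + 5 * suc k) + i
    expand = solve (i ∷ k ∷ [])
    end : 6 * i * suc k + 2 * i ≡ i * (k + 5 * suc k) + 3 * i
    end = solve (i ∷ k ∷ [])

  B≡B′ : ∀ i → B i (suc k) ≡ B′ i
  B≡B′ i = cong₂ Interval (B-start≡B′-start i) end
    where
    end : (2 * i + 1) * (3 * suc k) + 2 * i + 1 ≡ 3 * suc k + i * (k + 5 * suc k) + suc (3 * i)
    end = solve (i ∷ k ∷ [])

  H≐H₁ : H ≐ H₁ (suc k)
  H≐H₁ = H⊆H₁ , H₁⊆H
    where
    H⊆H₁ : H ⊆ H₁ (suc k)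
    H⊆H₁ {x} (i , inj₁ x∈A′) = i , inj₁ (subst (λ P → P x) (sym (A≡A′ i)) x∈A′)
    H⊆H₁ {x} (i , inj₂ x∈B′) = i , inj₂ (subst (λ P → P x) (sym (B≡B′ i)) x∈B′)
    H₁⊆H : H₁ (suc k) ⊆ H
    H₁⊆H {x} (i , inj₁ x∈A) = i , inj₁ (subst (λ P → P x) (A≡A′ i) x∈A)
    H₁⊆H {x} (i , inj₂ x∈B) = i , inj₂ (subst (λ P → P x) (B≡B′ i) x∈B)

lemma4p1 : (k : ℕ) → 1 ≤ k →
    IsSubmonoid (H₁ k)
    × (∀ x → Sk k x → H₁ k x)
    × (∀ x → (2 * (k ∸ 1) + 1) * (3 * k) ∸ (k ∸ 1) ≤ x → H₁ k x)
    × (∀ x → ⟨ Sk k ⟩ x ⇔ H₁ k x)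
    × IsPermutationNS 3 (H₁ k)
lemma4p1 (suc k) _ =
  IsSubmonoid-≐ (H≐H₁ k) H-isSubmonoid ,
  (λ x → H⊆H₁ ∘ S⊆H) ,
  (λ x x₀≤x → H⊆H₁ (H-cofinite k ≤-refl x (subst (_≤ x) (B-start≡B′-start k k) x₀≤x))) ,
  (λ x → mk⇔ (H⊆H₁ ∘ ⟨S⟩⊆H) (H⊆⟨S⟩ ∘ proj₂ (H≐H₁ k))) ,
  IsPermutationNS-≐ 3 (H≐H₁ k) (H-isPermutationNS (m∣m*n (suc k)))
  where
  open H₁-intervals k
  H⊆H₁ : H ⊆ H₁ (suc k)
  H⊆H₁ = proj₁ (H≐H₁ k)
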